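{- For every partition $\mu$, $\mathrm{PR}1(\mu)=\mathrm{PR}2(\mathrm{inc}(\mu))$, where \[ \mathrm{PR}1(\mu)=\prod_{(i,j)\in\mu}\bigl(1-q^{\mu_i-j}\,t^{\mu'_j-i+1}\bigr), \] the product being over cells $(i,j)$ (row $i$, column $j$) of the usual Young diagram of $\mu$ with rows of lengths $\mu_1\ge\mu_2\ge\cdots$, and \[ \mathrm{PR}2(\alpha)=\prod_{i\ge 1}(t;t)_{m_i}\prod_{\substack{s\in D(\mathrm{inc}(\alpha))\\ s \text{ not in the bottom row}}}\bigl(1-q^{\mathrm{leg}(s)+1}t^{\mathrm{arm}(s)+1}\bigr). \]
   Context: For a weak composition $\alpha=(\alpha_1,\dots,\alpha_n)$ (vector of nonnegative integers), $\mathrm{inc}(\alpha)$ is the vector obtained by sorting the parts of $\alpha$ into weakly increasing order; a partition $\mu$ is regarded as a weak composition (padding with zeros does not affect the statement). For $i\ge1$, $m_i$ is the number of parts of $\alpha$ equal to $i$, and $(t;t)_m=(1-t)(1-t^2)\cdots(1-t^m)$. $\mu'$ is the conjugate partition, so $\mu_i-j$ and $\mu'_j-i$ are the usual arm and leg of the cell $(i,j)$ of $\mu$. $D(\gamma)$ for a weak composition $\gamma=(\gamma_1,\dots,\gamma_n)$ is the diagram consisting of bottom-justified columns, the $k$-th column from the left having $\gamma_k$ cells; a cell is $(k,r)$ with $1\le r\le\gamma_k$ (row $r$ counted from the bottom, row $1$ the bottom row). For a cell $s=(k,r)$ of $D(\gamma)$: $\mathrm{leg}(s)$ is the number of cells in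 column $k$ strictly above $s$; $\mathrm{arm}(s)$ is the number of cells $(k',r)$ with $k'>k$ and $\gamma_{k'}\le\gamma_k$, plus (when $r\ge2$) the number of cells $(k',r-1)$ with $k'<k$ and $\gamma_{k'}<\gamma_k$. -}

module Defs where

open import Level using (Level)
open import Data.Nat using (ℕ; zero; suc; _≤_; _<_; _≤?_; _<?_; _∸_; _⊔_; _≟_; _+_)
open import Data.Nat.Properties using (≤-decTotalOrder)
open import Data.List using (List; []; _∷_; length; filter; map; upTo; foldr)
open import Data.Product using (_×_)
open import Relation.Nullary.Decidable using (_×-dec_)
open import Algebra.Bundles using (CommutativeRing)
import Data.List.Sort.InsertionSort as InsSort

-- at xs i = i-th entry of xs (1-based); 0 if out of range.
at : List ℕ → ℕ → ℕ
at []       _             = 0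
at (x ∷ xs) zero          = 0
at (x ∷ xs) (suc zero)    = x
at (x ∷ xs) (suc (suc i)) = at xs (suc i)

range : ℕ → ℕ → List ℕ
range a b = map (λ k → a + k) (upTo (suc b ∸ a))

inc : List ℕ → List ℕ
inc = InsSort.sort ≤-decTotalOrder

mult : List ℕ → ℕ → ℕ
mult α i = length (filter (λ x → x ≟ i) α)

maxPart : List ℕ → ℕ
maxPart = foldr _⊔_ 0

conj : List ℕ → ℕ → ℕ
conj μ j = length (filter (λ x → j ≤? x) μ)

-- Arm and leg in the diagram D(γ) (columns of heights γ_1..γ_n)

legD : List ℕ → ℕ → ℕ → ℕ
legD γ k r = at γ k ∸ r

-- arm(k,r) = #{ k' > k : γ_k' ≤ γ_k, (k',r) ∈ D(γ) }
--          + [r ≥ 2] #{ k' < k : γ_k' < γ_k, (k',r-1) ∈ D(γ) }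
armRight : List ℕ → ℕ → ℕ → ℕ
armRight γ k r =
  length (filter (λ k' → (at γ k' ≤? at γ k) ×-dec (r ≤? at γ k'))
                 (range (suc k) (length γ)))

armLeft : List ℕ → ℕ → ℕ → ℕ
armLeft γ k zero          = 0
armLeft γ k (suc zero)    = 0
armLeft γ k (suc (suc r₀)) =
  length (filter (λ k' → (at γ k' <? at γ k) ×-dec (suc r₀ ≤? at γ k'))
                 (range 1 (k ∸ 1)))

armD : List ℕ → ℕ → ℕ → ℕ
armD γ k r = armRight γ k r + armLeft γ k r

module _ {c ℓ : Level} (R : CommutativeRing c ℓ) where
  open CommutativeRing R

  pow : Carrier → ℕ → Carrier
  pow x zero    = 1#
  pow x (suc n) = x * pow x n

  prodL : List ℕ → (ℕ → Carrier) → Carrier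
  prodL xs f = foldr (λ x acc → f x * acc) 1# xs

  tPoch : Carrier → ℕ → Carrier
  tPoch t m = prodL (range 1 m) (λ a → 1# - pow t a)

  PR1 : Carrier → Carrier → List ℕ → Carrier
  PR1 q t μ =
    prodL (range 1 (length μ)) λ i →
      prodL (range 1 (at μ i)) λ j →
        1# - pow q (at μ i ∸ j) * pow t (suc (conj μ j ∸ i))

  PR2 : Carrier → Carrier → List ℕ → Carrier
  PR2 q t α =
    prodL (range 1 (maxPart α)) (λ i → tPoch t (mult α i))
    * prodL (range 1 (length γ)) λ k →
        prodL (range 2 (at γ k)) λ r →
          1# - pow q (suc (legD γ k r)) * pow t (suc (armD γ k r))
    where γ = inc α

-- Peel off the largest part h of μ = h ∷ ν. On the PR1 side this removes the first row: its last
-- cell gives 1 − t^(m+1), where m is the number of further parts equal to h, and its other cells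
-- form a column of height h whose arms count those m rows plus the shorter parts. On the PR2 side,
-- inc μ = inc ν ++ [h], so this removes the rightmost (tallest) column of D(inc μ), and the factors
-- 1 − t^(m+1) assemble into the (t;t)_{m_i}. The new column's arm counts no equal columns, while
-- every older column of height h gains one; hence within a block of equal parts the offsets
-- 0, …, m−1 occur in opposite orders on the two sides, which does not change the product.

module Submission where

open import Defs
open import Level using (Level)
open import Algebra.Bundles using (CommutativeRing)
open import Data.Bool using (Bool; true; false)
open import Data.Nat using (ℕ; zero; suc; _+_; _∸_; _≤_; _<_; _≥_; _≤?_; _<?_; _≟_; _⊔_; z≤n; s≤s)
open import Data.Nat.Properties
  using ( ≤-refl; ≤-reflexive; ≤-trans; ≤-antisym; ≤-pred; ≤-<-trans; <⇒≤; <⇒≢; <⇒≱; ≤∧≢⇒<; <-irrefl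
        ; n≤1+n; m≤m+n; +-assoc; +-comm; +-identityʳ; +-suc; +-∸-assoc; m+[n∸m]≡n; m≤n⇒m∸n≡0; m∸n≤m
        ; n∸n≡0; ⊔-identityʳ; ⊔-lub; m≤m⊔n; m≤n⊔m; m≤n⇒m⊔n≡n; ≤-decTotalOrder; +-commutativeSemigroup )
open import Algebra.Properties.CommutativeSemigroup +-commutativeSemigroup
  using ()
  renaming (interchange to +-interchange; xy∙z≈xz∙y to [m+n]+o≡[m+o]+n; x∙yz≈xz∙y to m+[n+o]≡[m+o]+n)
open import Data.List using (List; []; _∷_; _++_; [_]; length; filter; map; upTo)
open import Data.List.Properties
  using (length-++; map-++; upTo-∷ʳ; map-applyUpTo; map-∘; filter-accept; filter-reject; filter-none)
open import Data.List.Membership.Propositional using (_∈_)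
open import Data.List.Membership.Propositional.Properties using (∈-map⁻; ∈-upTo⁻)
open import Data.List.Relation.Unary.Any using (here; there)
open import Data.List.Relation.Unary.All as All using (All; []; _∷_)
open import Data.List.Relation.Unary.Linked as Linked using (Linked; _∷_)
open import Data.List.Relation.Unary.Linked.Properties using (Linked⇒All)
open import Data.List.Relation.Binary.Permutation.Propositional using (_↭_; ↭-sym)
open import Data.List.Relation.Binary.Permutation.Propositional.Properties using (↭-length; filter-↭; All-resp-↭)
open import Data.List.Sort.InsertionSort.Base ≤-decTotalOrder using (insert)
open import Data.List.Sort.InsertionSort.Properties ≤-decTotalOrder using (sort-↭; sort-↗)
open import Data.Product using (_×_; _,_; proj₁; proj₂)
open import Function using (_∘_; const; flip; mk⇔)
open import Relation.Nullary using (¬_; yes; no; does)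
open import Relation.Nullary.Decidable using (_×-dec_; dec-true; dec-false; does-⇔)
open import Relation.Unary using (Pred; Decidable)
open import Relation.Binary.PropositionalEquality using (_≡_; refl; sym; trans; cong; cong₂; module ≡-Reasoning)

private
  variable
    a b p p′ p″ : Level
    A : Set a
    B : Set b

-- Counting

indicator : Bool → ℕ
indicator true  = 1
indicator false = 0

count : {P : Pred A p} → Decidable P → List A → ℕ
count P? xs = length (filter P? xs)

module _ {P : Pred A p} (P? : Decidable P) where

  count-∷ : ∀ x xs → count P? (x ∷ xs) ≡ indicator (does (P? x)) + count P? xs
  count-∷ x xs with does (P? x)
  ... | true  = refl
  ... | false = refl

  count-accept : ∀ {x xs} → P x → count P? (x ∷ xs) ≡ suc (count P? xs)
  count-accept {x} {xs} px = cong length (filter-accept P? {x} {xs} px)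

  count-reject : ∀ {x xs} → ¬ P x → count P? (x ∷ xs) ≡ count P? xs
  count-reject {x} {xs} ¬px = cong length (filter-reject P? {x} {xs} ¬px)

  count-none : ∀ {xs} → All (¬_ ∘ P) xs → count P? xs ≡ 0
  count-none none = cong length (filter-none P? none)

  count-singleton : ∀ x → count P? [ x ] ≡ indicator (does (P? x))
  count-singleton x = trans (count-∷ x []) (+-identityʳ _)

  count-++ : ∀ xs ys → count P? (xs ++ ys) ≡ count P? xs + count P? ys
  count-++ []       ys = refl
  count-++ (x ∷ xs) ys = begin
    count P? (x ∷ xs ++ ys)            ≡⟨ count-∷ x (xs ++ ys) ⟩
    [x] + count P? (xs ++ ys)          ≡⟨ cong ([x] +_) (count-++ xs ys) ⟩
    [x] + (count P? xs + count P? ys)  ≡⟨ +-assoc [x] _ _ ⟨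
    ([x] + count P? xs) + count P? ys  ≡⟨ cong (_+ count P? ys) (count-∷ x xs) ⟨
    count P? (x ∷ xs) + count P? ys    ∎
    where
    open ≡-Reasoning
    [x] = indicator (does (P? x))

  count-↭ : ∀ {xs ys} → xs ↭ ys → count P? xs ≡ count P? ys
  count-↭ = ↭-length ∘ filter-↭ P?

count-map : {P : Pred A p} (P? : Decidable P) (f : B → A) → ∀ xs → count P? (map f xs) ≡ count (P? ∘ f) xs
count-map P? f []       = refl
count-map P? f (x ∷ xs) = begin
  count P? (f x ∷ map f xs)                               ≡⟨ count-∷ P? (f x) (map f xs) ⟩
  indicator (does (P? (f x))) + count P? (map f xs)       ≡⟨ cong (indicator (does (P? (f x))) +_) (count-map P? f xs) ⟩
  indicator (does (P? (f x))) + count (P? ∘ f) xs         ≡⟨ count-∷ (P? ∘ f) x xs ⟨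
  count (P? ∘ f) (x ∷ xs)                                 ∎
  where open ≡-Reasoning

count-cong : {P : Pred A p} {Q : Pred A p′} (P? : Decidable P) (Q? : Decidable Q) → ∀ xs →
             (∀ x → x ∈ xs → does (P? x) ≡ does (Q? x)) → count P? xs ≡ count Q? xs
count-cong P? Q? []       _  = refl
count-cong P? Q? (x ∷ xs) eq = begin
  count P? (x ∷ xs)                      ≡⟨ count-∷ P? x xs ⟩
  indicator (does (P? x)) + count P? xs  ≡⟨ cong₂ _+_ (cong indicator (eq x (here refl)))
                                                      (count-cong P? Q? xs λ y y∈ → eq y (there y∈)) ⟩
  indicator (does (Q? x)) + count Q? xs  ≡⟨ count-∷ Q? x xs ⟨
  count Q? (x ∷ xs)                      ∎
  where open ≡-Reasoning

count-split : {P : Pred A p} {Q : Pred A p′} {S : Pred A p″}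
              (P? : Decidable P) (Q? : Decidable Q) (S? : Decidable S) → ∀ xs →
              (∀ x → x ∈ xs → indicator (does (P? x)) ≡ indicator (does (Q? x)) + indicator (does (S? x))) →
              count P? xs ≡ count Q? xs + count S? xs
count-split P? Q? S? []       _     = refl
count-split P? Q? S? (x ∷ xs) split = begin
  count P? (x ∷ xs)                            ≡⟨ count-∷ P? x xs ⟩
  indicator (does (P? x)) + count P? xs        ≡⟨ cong₂ _+_ (split x (here refl))
                                                            (count-split P? Q? S? xs λ y y∈ → split y (there y∈)) ⟩
  ([Qx] + [Sx]) + (count Q? xs + count S? xs)  ≡⟨ +-interchange [Qx] [Sx] (count Q? xs) (count S? xs) ⟩
  ([Qx] + count Q? xs) + ([Sx] + count S? xs)  ≡⟨ cong₂ _+_ (count-∷ Q? x xs) (count-∷ S? x xs) ⟨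
  count Q? (x ∷ xs) + count S? (x ∷ xs)        ∎
  where
  open ≡-Reasoning
  [Qx] = indicator (does (Q? x))
  [Sx] = indicator (does (S? x))

-- Positions and index ranges

length-∷ʳ : ∀ (xs : List A) x → length (xs ++ [ x ]) ≡ suc (length xs)
length-∷ʳ xs x = trans (length-++ xs) (+-comm (length xs) 1)

at-++ˡ : ∀ xs ys {k} → 1 ≤ k × k ≤ length xs → at (xs ++ ys) k ≡ at xs k
at-++ˡ (x ∷ xs) ys {suc zero}    _             = refl
at-++ˡ (x ∷ xs) ys {suc (suc k)} (_ , s≤s k≤) = at-++ˡ xs ys (s≤s z≤n , k≤)

at-∷ʳ-last : ∀ xs h → at (xs ++ [ h ]) (suc (length xs)) ≡ h
at-∷ʳ-last []       h = refl
at-∷ʳ-last (x ∷ xs) h = at-∷ʳ-last xs h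

at-≤ : ∀ {h} xs k → All (_≤ h) xs → at xs k ≤ h
at-≤ []       k             _          = z≤n
at-≤ (x ∷ xs) zero          _          = z≤n
at-≤ (x ∷ xs) (suc zero)    (x≤ ∷ _)   = x≤
at-≤ (x ∷ xs) (suc (suc k)) (_ ∷ xs≤) = at-≤ xs (suc k) xs≤

m<n∸o⇒o+m<n : ∀ o {m n} → m < n ∸ o → o + m < n
m<n∸o⇒o+m<n zero    {n = n}     m<n = m<n
m<n∸o⇒o+m<n (suc o) {n = suc n} m<n = s≤s (m<n∸o⇒o+m<n o m<n)

∈-range⁻ : ∀ {a b x} → x ∈ range a b → a ≤ x × x ≤ b
∈-range⁻ {a} {b} x∈ with ∈-map⁻ (a +_) x∈
... | k , k∈ , refl = m≤m+n a k , ≤-pred (m<n∸o⇒o+m<n a (∈-upTo⁻ k∈))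

range-empty : ∀ {a b} → b < a → range a b ≡ []
range-empty {a} b<a = cong (map (a +_) ∘ upTo) (m≤n⇒m∸n≡0 b<a)

range-∷ʳ : ∀ {a} b → a ≤ suc b → range a (suc b) ≡ range a b ++ [ suc b ]
range-∷ʳ {a} b a≤ = begin
  map (a +_) (upTo (suc (suc b) ∸ a))            ≡⟨ cong (map (a +_) ∘ upTo) (+-∸-assoc 1 a≤) ⟩
  map (a +_) (upTo (suc (suc b ∸ a)))            ≡⟨ cong (map (a +_)) (upTo-∷ʳ (suc b ∸ a)) ⟨
  map (a +_) (upTo (suc b ∸ a) ++ [ suc b ∸ a ]) ≡⟨ map-++ (a +_) (upTo (suc b ∸ a)) _ ⟩
  range a b ++ [ a + (suc b ∸ a) ]               ≡⟨ cong (λ x → range a b ++ [ x ]) (m+[n∸m]≡n a≤) ⟩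
  range a b ++ [ suc b ]                         ∎
  where open ≡-Reasoning

range-1-suc : ∀ n → range 1 (suc n) ≡ 1 ∷ map suc (range 1 n)
range-1-suc n = cong (1 ∷_) (trans (map-applyUpTo suc suc n)
  (sym (trans (cong (map suc) (map-applyUpTo (λ k → k) suc n)) (map-applyUpTo suc suc n))))

range-2-suc : ∀ n → range 2 (suc n) ≡ map suc (range 1 n)
range-2-suc n = map-∘ (upTo n)

count-at-range : {P : Pred ℕ p} (P? : Decidable P) → ∀ γ → count (P? ∘ at γ) (range 1 (length γ)) ≡ count P? γ
count-at-range P? []       = refl
count-at-range P? (x ∷ xs) = begin
  count P⁺? (range 1 (suc (length xs)))     ≡⟨ cong (count P⁺?) (range-1-suc (length xs)) ⟩
  count P⁺? (1 ∷ map suc is)                ≡⟨ count-∷ P⁺? 1 (map suc is) ⟩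
  [x] + count P⁺? (map suc is)              ≡⟨ cong ([x] +_) (count-map P⁺? suc is) ⟩
  [x] + count (P⁺? ∘ suc) is                ≡⟨ cong ([x] +_) (count-cong (P⁺? ∘ suc) (P? ∘ at xs) is shift) ⟩
  [x] + count (P? ∘ at xs) is               ≡⟨ cong ([x] +_) (count-at-range P? xs) ⟩
  [x] + count P? xs                         ≡⟨ count-∷ P? x xs ⟨
  count P? (x ∷ xs)                         ∎
  where
  open ≡-Reasoning
  is  = range 1 (length xs)
  P⁺? = P? ∘ at (x ∷ xs)
  [x] = indicator (does (P? x))
  shift : ∀ k → k ∈ is → does (P⁺? (suc k)) ≡ does (P? (at xs k))
  shift (suc k) _  = refl
  shift zero    k∈ with () ← proj₁ (∈-range⁻ k∈)

-- Partitions and their increasing rearrangement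

Partition : List ℕ → Set
Partition = Linked _≥_

head-≥-tail : ∀ {h ν} → Partition (h ∷ ν) → All (_≤ h) ν
head-≥-tail μ↘ = All.tail (Linked⇒All (flip ≤-trans) ≤-refl μ↘)

head-≤-tail : ∀ {x xs} → Linked _≤_ (x ∷ xs) → All (x ≤_) xs
head-≤-tail xs↗ = All.tail (Linked⇒All ≤-trans ≤-refl xs↗)

count-inc : {P : Pred ℕ p} (P? : Decidable P) → ∀ xs → count P? (inc xs) ≡ count P? xs
count-inc P? xs = count-↭ P? (sort-↭ xs)

inc-All : {P : Pred ℕ p} → ∀ {xs} → All P xs → All P (inc xs)
inc-All {xs = xs} = All-resp-↭ (↭-sym (sort-↭ xs))

insert-min : ∀ {h} xs → All (h ≤_) xs → insert h xs ≡ h ∷ xs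
insert-min     []       _         = refl
insert-min {h} (y ∷ ys) (h≤y ∷ _) rewrite dec-true (h ≤? y) h≤y = refl

insert-max : ∀ {h} xs → Linked _≤_ xs → All (_≤ h) xs → insert h xs ≡ xs ++ [ h ]
insert-max     []       _   _            = refl
insert-max {h} (y ∷ ys) xs↗ (y≤h ∷ ys≤h) with h ≤? y
... | no  h≰y rewrite dec-false (h ≤? y) h≰y = cong (y ∷_) (insert-max ys (Linked.tail xs↗) ys≤h)
... | yes h≤y rewrite dec-true (h ≤? y) h≤y with refl ← ≤-antisym y≤h h≤y =
  cong (h ∷_) (trans (sym (insert-min ys (head-≤-tail xs↗))) (insert-max ys (Linked.tail xs↗) ys≤h))

inc-sorted : ∀ xs → Linked _≤_ xs → inc xs ≡ xs
inc-sorted []       _   = refl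
inc-sorted (x ∷ xs) xs↗ = trans (cong (insert x) (inc-sorted xs (Linked.tail xs↗))) (insert-min xs (head-≤-tail xs↗))

inc-∷ : ∀ {h ν} → Partition (h ∷ ν) → inc (h ∷ ν) ≡ inc ν ++ [ h ]
inc-∷ {h} {ν} μ↘ = insert-max (inc ν) (sort-↗ ν) (inc-All (head-≥-tail μ↘))

maxPart-∷ʳ : ∀ {h} xs → All (_≤ h) xs → maxPart (xs ++ [ h ]) ≡ h
maxPart-∷ʳ {h} []       _            = ⊔-identityʳ h
maxPart-∷ʳ     (x ∷ xs) (x≤h ∷ xs≤h) = trans (cong (x ⊔_) (maxPart-∷ʳ xs xs≤h)) (m≤n⇒m⊔n≡n x≤h)

maxPart-lub : ∀ {h} xs → All (_≤ h) xs → maxPart xs ≤ h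
maxPart-lub []       _            = z≤n
maxPart-lub (x ∷ xs) (x≤h ∷ xs≤h) = ⊔-lub x≤h (maxPart-lub xs xs≤h)

maxPart-ub : ∀ xs → All (_≤ maxPart xs) xs
maxPart-ub []       = []
maxPart-ub (x ∷ xs) = m≤m⊔n x (maxPart xs) ∷ All.map (λ y≤ → ≤-trans y≤ (m≤n⊔m x (maxPart xs))) (maxPart-ub xs)

-- Conjugates and arms

conj-∷ : ∀ {h j} ν → j ≤ h → conj (h ∷ ν) j ≡ suc (conj ν j)
conj-∷ {h} {j} ν j≤h = count-accept (j ≤?_) j≤h

conj-bound : ∀ {h} ν → All (_≤ h) ν → conj ν h ≡ mult ν h
conj-bound {h} ν ν≤h = count-cong (h ≤?_) (_≟ h) ν λ x x∈ →
  does-⇔ (mk⇔ (≤-antisym (All.lookup ν≤h x∈)) (≤-reflexive ∘ sym)) (h ≤? x) (x ≟ h)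

conj-below-bound : ∀ {h j} ν → All (_≤ h) ν → j ≤ h →
                   conj ν j ≡ mult ν h + count (λ x → (x <? h) ×-dec (j ≤? x)) ν
conj-below-bound {h} {j} ν ν≤h j≤h = count-split (j ≤?_) (_≟ h) between? ν λ x x∈ → split x (All.lookup ν≤h x∈)
  where
  between? = λ x → (x <? h) ×-dec (j ≤? x)
  split : ∀ x → x ≤ h → indicator (does (j ≤? x)) ≡ indicator (does (x ≟ h)) + indicator (does (between? x))
  split x x≤h with x ≟ h
  ... | yes refl = trans (cong indicator (dec-true (j ≤? x) j≤h))
    (sym (cong₂ (λ b b′ → indicator b + indicator b′)
                (dec-true (x ≟ x) refl) (dec-false (between? x) (<-irrefl refl ∘ proj₁))))
  ... | no  x≢h  = trans (cong indicator (does-⇔ (mk⇔ (≤∧≢⇒< x≤h x≢h ,_) proj₂) (j ≤? x) (between? x)))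
    (sym (cong (λ b → indicator b + indicator (does (between? x))) (dec-false (x ≟ h) x≢h)))

lastColumnArm : List ℕ → ℕ → ℕ → ℕ
lastColumnArm γ h zero          = 0
lastColumnArm γ h (suc zero)    = 0
lastColumnArm γ h (suc (suc r)) = count (λ x → (x <? h) ×-dec (suc r ≤? x)) γ

module _ (γ : List ℕ) (h : ℕ) where

  private
    n  = length γ
    γ⁺ = γ ++ [ h ]

  armD-∷ʳ-last : ∀ r → armD γ⁺ (suc n) r ≡ lastColumnArm γ h r
  armD-∷ʳ-last r = cong₂ _+_ noRight (left r)
    where
    noRight : armRight γ⁺ (suc n) r ≡ 0
    noRight = cong (count _) (trans (cong (range (2 + n)) (length-∷ʳ γ h)) (range-empty ≤-refl))
    left : ∀ r → armLeft γ⁺ (suc n) r ≡ lastColumnArm γ h r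
    left zero          = refl
    left (suc zero)    = refl
    left (suc (suc r)) = trans (count-cong _ (P? ∘ at γ) (range 1 n) old) (count-at-range P? γ)
      where
      P? = λ x → (x <? h) ×-dec (suc r ≤? x)
      old : ∀ k → k ∈ range 1 n → does ((at γ⁺ k <? at γ⁺ (suc n)) ×-dec (suc r ≤? at γ⁺ k)) ≡ does (P? (at γ k))
      old k k∈ = cong₂ (λ x y → does ((x <? y) ×-dec (suc r ≤? x)))
                       (at-++ˡ γ [ h ] (∈-range⁻ k∈)) (at-∷ʳ-last γ h)

  armD-∷ʳ : All (_≤ h) γ → ∀ {k r} → 1 ≤ k → k ≤ n → r ≤ at γ k →
            armD γ⁺ k r ≡ armD γ k r + indicator (does (at γ k ≟ h))
  armD-∷ʳ γ≤h {k} {r} 1≤k k≤n r≤γk = begin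
    armRight γ⁺ k r + armLeft γ⁺ k r          ≡⟨ cong₂ _+_ right (left r) ⟩
    (armRight γ k r + [k≡h]) + armLeft γ k r  ≡⟨ [m+n]+o≡[m+o]+n (armRight γ k r) [k≡h] (armLeft γ k r) ⟩
    armD γ k r + [k≡h]                        ∎
    where
    open ≡-Reasoning
    [k≡h] = indicator (does (at γ k ≟ h))
    atk   = at-++ˡ γ [ h ] (1≤k , k≤n)
    right : armRight γ⁺ k r ≡ armRight γ k r + [k≡h]
    right = begin
      count P⁺? (range (suc k) (length γ⁺))              ≡⟨ cong (count P⁺? ∘ range (suc k)) (length-∷ʳ γ h) ⟩
      count P⁺? (range (suc k) (suc n))                  ≡⟨ cong (count P⁺?) (range-∷ʳ n (s≤s k≤n)) ⟩
      count P⁺? (range (suc k) n ++ [ suc n ])           ≡⟨ count-++ P⁺? (range (suc k) n) [ suc n ] ⟩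
      count P⁺? (range (suc k) n) + count P⁺? [ suc n ]  ≡⟨ cong₂ _+_ (count-cong P⁺? _ (range (suc k) n) old)
                                                                     (trans (count-singleton P⁺? (suc n)) (cong indicator new)) ⟩
      armRight γ k r + [k≡h]                             ∎
      where
      P⁺? = λ k′ → (at γ⁺ k′ ≤? at γ⁺ k) ×-dec (r ≤? at γ⁺ k′)
      old : ∀ k′ → k′ ∈ range (suc k) n → does (P⁺? k′) ≡ does ((at γ k′ ≤? at γ k) ×-dec (r ≤? at γ k′))
      old k′ k′∈ with k<k′ , k′≤n ← ∈-range⁻ k′∈ =
        cong₂ (λ x y → does ((x ≤? y) ×-dec (r ≤? x))) (at-++ˡ γ [ h ] (≤-trans 1≤k (<⇒≤ k<k′) , k′≤n)) atk
      -- The new column is the tallest, so it lies in the arm of (k, r) exactly when column k has height h.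
      new : does (P⁺? (suc n)) ≡ does (at γ k ≟ h)
      new = trans (cong₂ (λ x y → does ((x ≤? y) ×-dec (r ≤? x))) (at-∷ʳ-last γ h) atk)
                  (does-⇔ (mk⇔ (λ (h≤ , _) → ≤-antisym γk≤h h≤) (λ γk≡h → ≤-reflexive (sym γk≡h) , ≤-trans r≤γk γk≤h))
                          ((h ≤? at γ k) ×-dec (r ≤? h)) (at γ k ≟ h))
        where γk≤h = at-≤ γ k γ≤h
    left : ∀ r → armLeft γ⁺ k r ≡ armLeft γ k r
    left zero          = refl
    left (suc zero)    = refl
    left (suc (suc r)) = count-cong _ _ (range 1 (k ∸ 1)) λ k′ k′∈ →
      let 1≤k′ , k′<k = ∈-range⁻ k′∈ in
      cong₂ (λ x y → does ((x <? y) ×-dec (suc r ≤? x)))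
            (at-++ˡ γ [ h ] (1≤k′ , ≤-trans k′<k (≤-trans (m∸n≤m k 1) k≤n))) atk

module Products {c ℓ : Level} (R : CommutativeRing c ℓ) where

  open CommutativeRing R
    using (Carrier; _≈_; _*_; reflexive; *-cong; *-assoc; *-identityˡ; *-identityʳ)
    renaming (refl to ≈-refl; sym to ≈-sym; trans to ≈-trans)

  private
    ∏ : List ℕ → (ℕ → Carrier) → Carrier
    ∏ = prodL R

  prodL-cong : ∀ xs {f g : ℕ → Carrier} → (∀ x → x ∈ xs → f x ≈ g x) → ∏ xs f ≈ ∏ xs g
  prodL-cong []       _   = ≈-refl
  prodL-cong (x ∷ xs) f≈g = *-cong (f≈g x (here refl)) (prodL-cong xs λ y y∈ → f≈g y (there y∈))

  prodL-++ : ∀ xs ys f → ∏ (xs ++ ys) f ≈ ∏ xs f * ∏ ys f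
  prodL-++ []       ys f = ≈-sym (*-identityˡ _)
  prodL-++ (x ∷ xs) ys f = ≈-trans (*-cong ≈-refl (prodL-++ xs ys f)) (≈-sym (*-assoc _ _ _))

  prodL-∷ʳ : ∀ xs x f → ∏ (xs ++ [ x ]) f ≈ ∏ xs f * f x
  prodL-∷ʳ xs x f = ≈-trans (prodL-++ xs [ x ] f) (*-cong ≈-refl (*-identityʳ _))

  prodL-map : ∀ xs (g : ℕ → ℕ) f → ∏ (map g xs) f ≡ ∏ xs (f ∘ g)
  prodL-map []       g f = refl
  prodL-map (x ∷ xs) g f = cong (f (g x) *_) (prodL-map xs g f)

  prodL-range-∷ʳ : ∀ b f → ∏ (range 1 (suc b)) f ≈ ∏ (range 1 b) f * f (suc b)
  prodL-range-∷ʳ b f =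
    ≈-trans (reflexive (cong (λ xs → ∏ xs f) (range-∷ʳ b (s≤s z≤n)))) (prodL-∷ʳ (range 1 b) (suc b) f)

module CellFactors {c ℓ : Level} (R : CommutativeRing c ℓ) (q t : CommutativeRing.Carrier R) where

  open CommutativeRing R
    using ( Carrier; _≈_; _*_; 1#; _-_; setoid; reflexive; *-cong; +-cong; -‿cong
          ; *-assoc; *-comm; *-identityˡ; *-identityʳ; *-commutativeSemigroup )
    renaming (refl to ≈-refl; sym to ≈-sym; trans to ≈-trans)
  open import Relation.Binary.Reasoning.Setoid setoid
  open import Algebra.Properties.CommutativeSemigroup *-commutativeSemigroup using (interchange; x∙yz≈y∙xz)
  open Products R

  private
    ∏ : List ℕ → (ℕ → Carrier) → Carrier
    ∏ = prodL R

  factor : ℕ → ℕ → Carrier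
  factor a b = 1# - pow R q a * pow R t b

  column : ℕ → (ℕ → ℕ) → Carrier
  column g arm = ∏ (range 2 g) λ r → factor (suc (g ∸ r)) (suc (arm r))

  column-cong : ∀ {g g′} → g ≡ g′ → ∀ {arm arm′} → (∀ r → r ≤ g′ → arm r ≡ arm′ r) →
                column g arm ≈ column g′ arm′
  column-cong {g} refl arm≡ = prodL-cong (range 2 g) λ r r∈ →
    reflexive (cong (factor (suc (g ∸ r)) ∘ suc) (arm≡ r (proj₂ (∈-range⁻ r∈))))

  lastColumn : ℕ → ℕ → List ℕ → Carrier
  lastColumn h e γ = column h λ r → e + lastColumnArm γ h r

  -- With E = const 0 this is the product over D(γ) in PR2; E x lengthens the arms in columns of height x.
  diagram : List ℕ → (ℕ → ℕ) → Carrier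
  diagram γ E = ∏ (range 1 (length γ)) λ k → column (at γ k) λ r → E (at γ k) + armD γ k r

  raiseAt : (ℕ → ℕ) → ℕ → ℕ → ℕ
  raiseAt E h x = E x + indicator (does (x ≟ h))

  diagram-∷ʳ : ∀ γ h E → All (_≤ h) γ → diagram (γ ++ [ h ]) E ≈ diagram γ (raiseAt E h) * lastColumn h (E h) γ
  diagram-∷ʳ γ h E γ≤h = begin
    ∏ (range 1 (length γ⁺)) col⁺                   ≡⟨ cong (λ m → ∏ (range 1 m) col⁺) (length-∷ʳ γ h) ⟩
    ∏ (range 1 (suc n)) col⁺                       ≈⟨ prodL-range-∷ʳ n col⁺ ⟩
    ∏ (range 1 n) col⁺ * col⁺ (suc n)              ≈⟨ *-cong (prodL-cong (range 1 n) λ k k∈ → old (∈-range⁻ k∈)) new ⟩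
    diagram γ (raiseAt E h) * lastColumn h (E h) γ ∎
    where
    n  = length γ
    γ⁺ = γ ++ [ h ]
    col⁺ : ℕ → Carrier
    col⁺ k = column (at γ⁺ k) λ r → E (at γ⁺ k) + armD γ⁺ k r
    old : ∀ {k} → 1 ≤ k × k ≤ n → col⁺ k ≈ column (at γ k) λ r → raiseAt E h (at γ k) + armD γ k r
    old {k} (1≤k , k≤n) = column-cong (at-++ˡ γ [ h ] (1≤k , k≤n)) λ r r≤ →
      trans (cong₂ _+_ (cong E (at-++ˡ γ [ h ] (1≤k , k≤n))) (armD-∷ʳ γ h γ≤h 1≤k k≤n r≤))
            (m+[n+o]≡[m+o]+n (E (at γ k)) (armD γ k r) (indicator (does (at γ k ≟ h))))
    new : col⁺ (suc n) ≈ lastColumn h (E h) γ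
    new = column-cong (at-∷ʳ-last γ h) λ r _ → cong₂ _+_ (cong E (at-∷ʳ-last γ h)) (armD-∷ʳ-last γ h r)

  lastColumn-inc : ∀ h e ν → lastColumn h e (inc ν) ≈ lastColumn h e ν
  lastColumn-inc h e ν = column-cong {h} refl λ r _ → cong (e +_) (arm r)
    where
    arm : ∀ r → lastColumnArm (inc ν) h r ≡ lastColumnArm ν h r
    arm zero          = refl
    arm (suc zero)    = refl
    arm (suc (suc r)) = count-inc _ ν

  lastColumn-∷-≥ : ∀ h {x} e ν → h ≤ x → lastColumn h e (x ∷ ν) ≈ lastColumn h e ν
  lastColumn-∷-≥ h {x} e ν h≤x = column-cong {h} refl λ r _ → cong (e +_) (arm r)
    where
    arm : ∀ r → lastColumnArm (x ∷ ν) h r ≡ lastColumnArm ν h r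
    arm zero          = refl
    arm (suc zero)    = refl
    arm (suc (suc r)) = count-reject (λ y → (y <? h) ×-dec (suc r ≤? y)) λ (x<h , _) → <⇒≱ x<h h≤x

  -- The column of the i-th part gets extra arm E νᵢ plus the number of parts equal to νᵢ
  -- before it (columnsEarlier) or after it (columnsLater).
  columnsEarlier : (ℕ → ℕ) → List ℕ → Carrier
  columnsEarlier E []      = 1#
  columnsEarlier E (h ∷ ν) = lastColumn h (E h) ν * columnsEarlier (raiseAt E h) ν

  columnsLater : (ℕ → ℕ) → List ℕ → Carrier
  columnsLater E []      = 1#
  columnsLater E (h ∷ ν) = lastColumn h (E h + mult ν h) ν * columnsLater E ν

  diagram-inc : ∀ ν → Partition ν → ∀ E → diagram (inc ν) E ≈ columnsEarlier E ν
  diagram-inc []      _  E = ≈-refl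
  diagram-inc (h ∷ ν) μ↘ E = begin
    diagram (inc (h ∷ ν)) E                                    ≡⟨ cong (λ γ → diagram γ E) (inc-∷ μ↘) ⟩
    diagram (inc ν ++ [ h ]) E                                 ≈⟨ diagram-∷ʳ (inc ν) h E (inc-All (head-≥-tail μ↘)) ⟩
    diagram (inc ν) (raiseAt E h) * lastColumn h (E h) (inc ν) ≈⟨ *-cong (diagram-inc ν (Linked.tail μ↘) (raiseAt E h))
                                                                          (lastColumn-inc h (E h) ν) ⟩
    columnsEarlier (raiseAt E h) ν * lastColumn h (E h) ν      ≈⟨ *-comm _ _ ⟩
    columnsEarlier E (h ∷ ν)                                   ∎

  columnsLater-cong : ∀ {E E′} ν → All (λ x → E x ≡ E′ x) ν → columnsLater E ν ≈ columnsLater E′ ν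
  columnsLater-cong []      []          = ≈-refl
  columnsLater-cong (h ∷ ν) (E≡E′ ∷ eqs) =
    *-cong (reflexive (cong (λ e → lastColumn h (e + mult ν h) ν) E≡E′)) (columnsLater-cong ν eqs)

  columnsLater-raiseAt : ∀ E h ν → Partition (h ∷ ν) →
    lastColumn h (E h) ν * columnsLater (raiseAt E h) ν ≈ lastColumn h (E h + mult ν h) ν * columnsLater E ν
  columnsLater-raiseAt E h []      _          = reflexive (cong (λ e → lastColumn h e [] * 1#) (sym (+-identityʳ (E h))))
  columnsLater-raiseAt E h (x ∷ ν) (x≤h ∷ ν↘) with x ≟ h
  ... | yes refl = begin
    lastColumn h e (h ∷ ν) * (lastColumn h (raiseAt E h h + m) ν * columnsLater (raiseAt E h) ν)
      ≈⟨ *-cong (lastColumn-∷-≥ h e ν ≤-refl) (*-cong (reflexive (cong (λ e′ → lastColumn h (e′ + m) ν) raised)) ≈-refl) ⟩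
    lastColumn h e ν * (lastColumn h (e + 1 + m) ν * columnsLater (raiseAt E h) ν)
      ≈⟨ x∙yz≈y∙xz _ _ _ ⟩
    lastColumn h (e + 1 + m) ν * (lastColumn h e ν * columnsLater (raiseAt E h) ν)
      ≈⟨ *-cong ≈-refl (columnsLater-raiseAt E h ν ν↘) ⟩
    lastColumn h (e + 1 + m) ν * (lastColumn h (e + m) ν * columnsLater E ν)
      ≈⟨ *-cong (reflexive (cong (λ e′ → lastColumn h e′ ν) counted)) ≈-refl ⟨
    lastColumn h (e + mult (h ∷ ν) h) ν * (lastColumn h (e + m) ν * columnsLater E ν)
      ≈⟨ *-cong (lastColumn-∷-≥ h (e + mult (h ∷ ν) h) ν ≤-refl) ≈-refl ⟨
    lastColumn h (e + mult (h ∷ ν) h) (h ∷ ν) * (lastColumn h (e + m) ν * columnsLater E ν) ∎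
    where
    e = E h
    m = mult ν h
    raised : raiseAt E h h ≡ e + 1
    raised = cong (λ b → e + indicator b) (dec-true (h ≟ h) refl)
    counted : e + mult (h ∷ ν) h ≡ e + 1 + m
    counted = trans (cong (e +_) (count-accept (_≟ h) refl)) (sym (+-assoc e 1 m))
  ... | no x≢h = *-cong (reflexive (cong (λ e → lastColumn h e (x ∷ ν)) unshifted)) (columnsLater-cong (x ∷ ν) unraised)
    where
    below : All (_< h) (x ∷ ν)
    below = ≤∧≢⇒< x≤h x≢h ∷ All.map (λ y≤x → ≤-<-trans y≤x (≤∧≢⇒< x≤h x≢h)) (head-≥-tail ν↘)
    absent : mult (x ∷ ν) h ≡ 0
    absent = count-none (_≟ h) (All.map <⇒≢ below)
    unshifted : E h ≡ E h + mult (x ∷ ν) h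
    unshifted = sym (trans (cong (E h +_) absent) (+-identityʳ (E h)))
    unraised : All (λ y → raiseAt E h y ≡ E y) (x ∷ ν)
    unraised = All.map (λ {y} y<h → trans (cong (λ b → E y + indicator b) (dec-false (y ≟ h) (<⇒≢ y<h)))
                                          (+-identityʳ (E y))) below

  columnsEarlier≈columnsLater : ∀ ν → Partition ν → ∀ E → columnsEarlier E ν ≈ columnsLater E ν
  columnsEarlier≈columnsLater []      _  E = ≈-refl
  columnsEarlier≈columnsLater (h ∷ ν) μ↘ E = ≈-trans
    (*-cong ≈-refl (columnsEarlier≈columnsLater ν (Linked.tail μ↘) (raiseAt E h)))
    (columnsLater-raiseAt E h ν μ↘)

  firstRow : ℕ → List ℕ → Carrier
  firstRow h ν = ∏ (range 1 h) λ j → factor (h ∸ j) (suc (conj ν j))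

  PR1-∷ : ∀ {h ν} → Partition (h ∷ ν) → PR1 R q t (h ∷ ν) ≈ firstRow h ν * PR1 R q t ν
  PR1-∷ {h} {ν} μ↘ = begin
    ∏ (range 1 (suc n)) row               ≡⟨ cong (λ is → ∏ is row) (range-1-suc n) ⟩
    row 1 * ∏ (map suc (range 1 n)) row   ≡⟨ cong (row 1 *_) (prodL-map (range 1 n) suc row) ⟩
    row 1 * ∏ (range 1 n) (row ∘ suc)     ≈⟨ *-cong first (prodL-cong (range 1 n) rest) ⟩
    firstRow h ν * PR1 R q t ν            ∎
    where
    n = length ν
    row : ℕ → Carrier
    row i = ∏ (range 1 (at (h ∷ ν) i)) λ j → factor (at (h ∷ ν) i ∸ j) (suc (conj (h ∷ ν) j ∸ i))
    first : row 1 ≈ firstRow h ν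
    first = prodL-cong (range 1 h) λ j j∈ →
      reflexive (cong (λ c → factor (h ∸ j) (suc (c ∸ 1))) (conj-∷ ν (proj₂ (∈-range⁻ j∈))))
    rest : ∀ i → i ∈ range 1 n → row (suc i) ≈ ∏ (range 1 (at ν i)) λ j → factor (at ν i ∸ j) (suc (conj ν j ∸ i))
    rest zero    i∈ with () ← proj₁ (∈-range⁻ i∈)
    rest (suc i) _  = prodL-cong (range 1 (at ν (suc i))) λ j j∈ →
      reflexive (cong (λ c → factor (at ν (suc i) ∸ j) (suc (c ∸ suc (suc i))))
                      (conj-∷ ν (≤-trans (proj₂ (∈-range⁻ j∈)) (at-≤ ν (suc i) (head-≥-tail μ↘)))))

  rowEndFactor : ℕ → List ℕ → Carrier
  rowEndFactor zero    ν = 1#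
  rowEndFactor (suc h) ν = factor 0 (suc (mult ν (suc h)))

  firstRow-split : ∀ h ν → All (_≤ h) ν → firstRow h ν ≈ lastColumn h (mult ν h) ν * rowEndFactor h ν
  firstRow-split zero    ν _   = ≈-sym (*-identityˡ 1#)
  firstRow-split (suc g) ν ν≤h = begin
    ∏ (range 1 (suc g)) cell                          ≈⟨ prodL-range-∷ʳ g cell ⟩
    ∏ (range 1 g) cell * cell (suc g)                 ≈⟨ *-cong (prodL-cong (range 1 g) inner) corner ⟩
    ∏ (range 1 g) (colCell ∘ suc) * rowEndFactor h ν  ≡⟨ cong (_* rowEndFactor h ν) shifted ⟩
    lastColumn h m ν * rowEndFactor h ν               ∎
    where
    h = suc g
    m = mult ν h
    cell : ℕ → Carrier
    cell j = factor (h ∸ j) (suc (conj ν j))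
    colCell : ℕ → Carrier
    colCell r = factor (suc (h ∸ r)) (suc (m + lastColumnArm ν h r))
    corner : cell h ≈ rowEndFactor h ν
    corner = reflexive (cong₂ (λ a c → factor a (suc c)) (n∸n≡0 h) (conj-bound ν ν≤h))
    inner : ∀ j → j ∈ range 1 g → cell j ≈ colCell (suc j)
    inner zero    j∈ with () ← proj₁ (∈-range⁻ j∈)
    inner (suc j) j∈ = reflexive (cong₂ (λ a c → factor a (suc c)) (+-∸-assoc 1 j≤g)
                                        (conj-below-bound ν ν≤h (≤-trans j≤g (n≤1+n g))))
      where j≤g = proj₂ (∈-range⁻ j∈)
    shifted : ∏ (range 1 g) (colCell ∘ suc) ≡ lastColumn h m ν
    shifted = trans (sym (prodL-map (range 1 g) suc colCell)) (cong (λ is → ∏ is colCell) (sym (range-2-suc g)))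

  tPochProduct : ℕ → List ℕ → Carrier
  tPochProduct M ν = ∏ (range 1 M) λ i → tPoch R t (mult ν i)

  tPochProduct-inc : ∀ M ν → tPochProduct M (inc ν) ≈ tPochProduct M ν
  tPochProduct-inc M ν = prodL-cong (range 1 M) λ i _ → reflexive (cong (tPoch R t) (count-inc (_≟ i) ν))

  tPochProduct-+ : ∀ M ν d → All (_≤ M) ν → tPochProduct (M + d) ν ≈ tPochProduct M ν
  tPochProduct-+ M ν zero    _   = reflexive (cong (λ N → tPochProduct N ν) (+-identityʳ M))
  tPochProduct-+ M ν (suc d) ν≤M = begin
    tPochProduct (M + suc d) ν                                 ≡⟨ cong (λ N → tPochProduct N ν) (+-suc M d) ⟩
    tPochProduct (suc (M + d)) ν                               ≈⟨ prodL-range-∷ʳ (M + d) _ ⟩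
    tPochProduct (M + d) ν * tPoch R t (mult ν (suc (M + d)))  ≡⟨ cong (λ c → tPochProduct (M + d) ν * tPoch R t c) absent ⟩
    tPochProduct (M + d) ν * 1#                                ≈⟨ *-identityʳ _ ⟩
    tPochProduct (M + d) ν                                     ≈⟨ tPochProduct-+ M ν d ν≤M ⟩
    tPochProduct M ν                                           ∎
    where
    absent : mult ν (suc (M + d)) ≡ 0
    absent = count-none (_≟ suc (M + d)) (All.map (λ x≤M → <⇒≢ (s≤s (≤-trans x≤M (m≤m+n M d)))) ν≤M)

  tPoch-suc : ∀ m → tPoch R t (suc m) ≈ tPoch R t m * factor 0 (suc m)
  tPoch-suc m = ≈-trans (prodL-range-∷ʳ m _) (*-cong ≈-refl (+-cong ≈-refl (-‿cong (≈-sym (*-identityˡ _)))))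

  tPochProduct-∷ : ∀ h ν → tPochProduct h (h ∷ ν) ≈ rowEndFactor h ν * tPochProduct h ν
  tPochProduct-∷ zero    ν = ≈-sym (*-identityˡ 1#)
  tPochProduct-∷ (suc g) ν = begin
    tPochProduct h (h ∷ ν)                                     ≈⟨ prodL-range-∷ʳ g _ ⟩
    ∏ (range 1 g) (poch (h ∷ ν)) * tPoch R t (mult (h ∷ ν) h)  ≈⟨ *-cong (prodL-cong (range 1 g) others)
                                                                          (reflexive (cong (tPoch R t) (count-accept (_≟ h) refl))) ⟩
    ∏ (range 1 g) (poch ν) * tPoch R t (suc (mult ν h))        ≈⟨ *-cong ≈-refl (tPoch-suc (mult ν h)) ⟩
    ∏ (range 1 g) (poch ν) * (poch ν h * rowEndFactor h ν)     ≈⟨ *-assoc _ _ _ ⟨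
    (∏ (range 1 g) (poch ν) * poch ν h) * rowEndFactor h ν     ≈⟨ *-cong (prodL-range-∷ʳ g (poch ν)) ≈-refl ⟨
    tPochProduct h ν * rowEndFactor h ν                        ≈⟨ *-comm _ _ ⟩
    rowEndFactor h ν * tPochProduct h ν                        ∎
    where
    h = suc g
    poch : List ℕ → ℕ → Carrier
    poch xs i = tPoch R t (mult xs i)
    others : ∀ i → i ∈ range 1 g → poch (h ∷ ν) i ≈ poch ν i
    others i i∈ = reflexive (cong (tPoch R t) (count-reject (_≟ i) (<⇒≢ (s≤s (proj₂ (∈-range⁻ i∈))) ∘ sym)))

  tPochFactor : List ℕ → Carrier
  tPochFactor μ = tPochProduct (maxPart (inc μ)) (inc μ)

  tPochFactor-∷ : ∀ {h ν} → Partition (h ∷ ν) → tPochFactor (h ∷ ν) ≈ rowEndFactor h ν * tPochFactor ν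
  tPochFactor-∷ {h} {ν} μ↘ = begin
    tPochProduct (maxPart (inc (h ∷ ν))) (inc (h ∷ ν))  ≈⟨ tPochProduct-inc (maxPart (inc (h ∷ ν))) (h ∷ ν) ⟩
    tPochProduct (maxPart (inc (h ∷ ν))) (h ∷ ν)        ≡⟨ cong (λ N → tPochProduct N (h ∷ ν)) maxPart≡h ⟩
    tPochProduct h (h ∷ ν)                              ≈⟨ tPochProduct-∷ h ν ⟩
    rowEndFactor h ν * tPochProduct h ν                 ≡⟨ cong (λ N → rowEndFactor h ν * tPochProduct N ν) (m+[n∸m]≡n M≤h) ⟨
    rowEndFactor h ν * tPochProduct (M + (h ∸ M)) ν     ≈⟨ *-cong ≈-refl (tPochProduct-+ M ν (h ∸ M) ν≤M) ⟩
    rowEndFactor h ν * tPochProduct M ν                 ≈⟨ *-cong ≈-refl (tPochProduct-inc M ν) ⟨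
    rowEndFactor h ν * tPochFactor ν                    ∎
    where
    inc≤h = inc-All (head-≥-tail μ↘)
    maxPart≡h = trans (cong maxPart (inc-∷ μ↘)) (maxPart-∷ʳ (inc ν) inc≤h)
    M = maxPart (inc ν)
    M≤h = maxPart-lub (inc ν) inc≤h
    ν≤M : All (_≤ M) ν
    ν≤M = All-resp-↭ (sort-↭ ν) (maxPart-ub (inc ν))

  PR1≈columnsLater : ∀ μ → Partition μ → PR1 R q t μ ≈ columnsLater (const 0) μ * tPochFactor μ
  PR1≈columnsLater []      _  = ≈-sym (*-identityˡ 1#)
  PR1≈columnsLater (h ∷ ν) μ↘ = begin
    PR1 R q t (h ∷ ν)
      ≈⟨ PR1-∷ μ↘ ⟩
    firstRow h ν * PR1 R q t ν
      ≈⟨ *-cong (firstRow-split h ν (head-≥-tail μ↘)) (PR1≈columnsLater ν (Linked.tail μ↘)) ⟩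
    (lastColumn h m ν * rowEndFactor h ν) * (columnsLater (const 0) ν * tPochFactor ν)
      ≈⟨ interchange _ _ _ _ ⟩
    (lastColumn h m ν * columnsLater (const 0) ν) * (rowEndFactor h ν * tPochFactor ν)
      ≈⟨ *-cong ≈-refl (tPochFactor-∷ μ↘) ⟨
    columnsLater (const 0) (h ∷ ν) * tPochFactor (h ∷ ν)
      ∎
    where m = mult ν h

mainTheorem2 : ∀ {c ℓ : Level} (R : CommutativeRing c ℓ) (q t : CommutativeRing.Carrier R)
    (μ : List ℕ) → Linked _≥_ μ →
    CommutativeRing._≈_ R (PR1 R q t μ) (PR2 R q t (inc μ))
mainTheorem2 R q t μ μ↘ = begin
  PR1 R q t μ                                 ≈⟨ PR1≈columnsLater μ μ↘ ⟩
  columnsLater (const 0) μ * tPochFactor μ    ≈⟨ *-comm _ _ ⟩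
  tPochFactor μ * columnsLater (const 0) μ    ≈⟨ *-cong ≈-refl (columnsEarlier≈columnsLater μ μ↘ (const 0)) ⟨
  tPochFactor μ * columnsEarlier (const 0) μ  ≈⟨ *-cong ≈-refl (diagram-inc μ μ↘ (const 0)) ⟨
  tPochFactor μ * diagram (inc μ) (const 0)   ≡⟨ cong (λ γ → tPochFactor μ * diagram γ (const 0))
                                                    (inc-sorted (inc μ) (sort-↗ μ)) ⟨
  PR2 R q t (inc μ)                           ∎
  where
  open CommutativeRing R using (setoid; _*_; *-comm; *-cong) renaming (refl to ≈-refl)
  open import Relation.Binary.Reasoning.Setoid setoid
  open CellFactors R q t
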